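{- Every $aa$-representable graph (equivalently, every word-representable graph) is $aab$-representable.
   Context: Graphs are finite, simple, undirected. Two words are isomorphic if one is obtained from the other by a bijective renaming of letters. For a word $w$ and letters $x,y$, $w|_{xy}$ denotes the subword of $w$ consisting of all occurrences of $x$ and $y$ (in order). A word $u$ over letters from $\{a,b\}$ occurs in $w|_{xy}$ ($x\neq y$) if some contiguous factor of $w|_{xy}$ is isomorphic to $u$ (for $u=aa$: two equal consecutive letters; for $u=aab$: a factor of the form $zzz'$ with $\{z,z'\}=\{x,y\}$); otherwise $w|_{xy}$ avoids $u$. For a word $t$, a graph $G=(V,E)$ is $t$-representable if there is a word $w$ over the alphabet $V$ containing each letter of $V$ at least once such that for all distinct $x,y\in V$, $xy\in E$ if and only if $w|_{xy}$ avoids $t$. $aa$-representability coincides with word-representability, where $xy\in E$ iff $x$ and $y$ alternate in $w$. -}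

module Defs where

open import Data.Nat using (ℕ)
open import Data.Fin using (Fin)
open import Data.Fin.Properties using (_≟_)
open import Data.List using (List; []; _∷_; _++_; length; filter; lookup)
open import Data.List.Membership.Propositional using (_∈_)
open import Data.Product using (Σ; ∃; ∃-syntax; _×_; _,_)
open import Data.Sum using (_⊎_)
open import Relation.Binary.PropositionalEquality using (_≡_; _≢_; subst)
open import Relation.Nullary using (¬_)
open import Relation.Nullary.Decidable using (_⊎-dec_)
open import Function.Bundles using (_⇔_)
open import Level using (0ℓ)

record Graph (n : ℕ) : Set₁ where
  field
    Adj     : Fin n → Fin n → Set
    irrefl  : ∀ x → ¬ Adj x x
    sym     : ∀ x y → Adj x y → Adj y x
open Graph public

-- Two words are isomorphic iff they have the same length and
-- the same equality pattern between positions (equivalently, one is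
-- obtained from the other by a bijective renaming of letters).
Isomorphic : {A B : Set} → List A → List B → Set
Isomorphic u v =
  Σ (length u ≡ length v) λ eq →
    ∀ (i j : Fin (length u)) →
      (lookup u i ≡ lookup u j) ⇔
      (lookup v (subst Fin eq i) ≡ lookup v (subst Fin eq j))

Occurs : {A B : Set} → List A → List B → Set
Occurs {B = B} u v =
  ∃[ p ] ∃[ f ] ∃[ s ] ((v ≡ p ++ f ++ s) × Isomorphic u f)

Avoids : {A B : Set} → List A → List B → Set
Avoids u v = ¬ Occurs u v

restrict : {n : ℕ} → List (Fin n) → Fin n → Fin n → List (Fin n)
restrict w x y = filter (λ z → (z ≟ x) ⊎-dec (z ≟ y)) w

data Letter : Set where
  a b : Letter

Representable : {n : ℕ} → List Letter → Graph n → Set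
Representable {n} t G =
  ∃[ w ] ((∀ (x : Fin n) → x ∈ w) ×
          (∀ (x y : Fin n) → x ≢ y →
             (Adj G x y ⇔ Avoids t (restrict w x y))))

aa-word : List Letter
aa-word = a ∷ a ∷ []

aab-word : List Letter
aab-word = a ∷ a ∷ b ∷ []

module Submission where

-- If w represents G (x, y adjacent iff x and y alternate in w), then
-- w ++ lastOcc w represents G in the aab sense, where lastOcc w lists the
-- letters of w in the order of their last occurrences.  The argument is
-- local to a pair x ≢ y with u = w|_{xy}:
--   * restriction commutes with lastOcc, so (w ++ lastOcc w)|_{xy} is
--     u ++ lastOcc u, i.e. u followed by "the other letter, then the last
--     letter of u";
--   * a word contains aa iff it has a square zz, and contains aab only if
--     it has a square;
--   * if u is square-free, so is u ++ lastOcc u (lastOcc u is square-free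
--     and cannot start with the last letter of u), hence it avoids aab;
--   * if u has a square zz, then some later letter of u ++ lastOcc u differs
--     from z, and the last square before it yields a factor zzz'.

open import Defs hiding (sym)
open import Data.Nat using (ℕ)
open import Data.Fin using (Fin; zero; suc)
open import Data.Fin.Properties using (_≟_)
open import Data.List using (List; []; _∷_; [_]; _++_; filter)
open import Data.List.Properties using (filter-++; ++-assoc; ∷-injective; ∷-injectiveʳ)
open import Data.List.Relation.Unary.Any using (here; there)
open import Data.List.Membership.Propositional using (_∈_)
open import Data.List.Membership.Propositional.Properties
  using (∈-filter⁺; ∈-filter⁻; ∈-++⁺ˡ; ∈-++⁺ʳ)
import Data.List.Membership.DecPropositional as DecMembership
open import Data.Product using (Σ; _×_; _,_; proj₁)
open import Data.Sum using (_⊎_; inj₁; inj₂)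
import Data.Sum as Sum
open import Data.Empty using (⊥-elim)
open import Function using (_∘_)
open import Relation.Binary.Definitions using (DecidableEquality)
open import Relation.Binary.PropositionalEquality
  using (_≡_; _≢_; refl; sym; trans; cong; subst)
open import Relation.Nullary using (¬_; yes; no)
open import Relation.Nullary.Decidable using (_⊎-dec_)
open import Relation.Unary using (Pred; Decidable)
open import Function.Bundles using (_⇔_; mk⇔; Equivalence)
open import Function.Construct.Composition using (_⇔-∘_)

HasSquare : {B : Set} → List B → Set
HasSquare {B} v = Σ (List B) λ p → Σ B λ z → Σ (List B) λ s → v ≡ p ++ z ∷ z ∷ s

aa-at : {B : Set} (p : List B) (z : B) (s : List B) → Occurs aa-word (p ++ z ∷ z ∷ s)
aa-at p z s = p , z ∷ z ∷ [] , s , refl , iso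
  where
  iso : Isomorphic aa-word (z ∷ z ∷ [])
  iso = refl , λ
    { zero       zero       → mk⇔ (λ _ → refl) (λ _ → refl)
    ; zero       (suc zero) → mk⇔ (λ _ → refl) (λ _ → refl)
    ; (suc zero) zero       → mk⇔ (λ _ → refl) (λ _ → refl)
    ; (suc zero) (suc zero) → mk⇔ (λ _ → refl) (λ _ → refl)
    }

aab-at : {B : Set} (p : List B) {z z' : B} (s : List B) → z ≢ z' →
  Occurs aab-word (p ++ z ∷ z ∷ z' ∷ s)
aab-at p {z} {z'} s z≢z' = p , z ∷ z ∷ z' ∷ [] , s , refl , iso
  where
  iso : Isomorphic aab-word (z ∷ z ∷ z' ∷ [])
  iso = refl , λ
    { zero             zero             → mk⇔ (λ _ → refl) (λ _ → refl)
    ; zero             (suc zero)       → mk⇔ (λ _ → refl) (λ _ → refl)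
    ; zero             (suc (suc zero)) → mk⇔ (λ ()) (⊥-elim ∘ z≢z')
    ; (suc zero)       zero             → mk⇔ (λ _ → refl) (λ _ → refl)
    ; (suc zero)       (suc zero)       → mk⇔ (λ _ → refl) (λ _ → refl)
    ; (suc zero)       (suc (suc zero)) → mk⇔ (λ ()) (⊥-elim ∘ z≢z')
    ; (suc (suc zero)) zero             → mk⇔ (λ ()) (⊥-elim ∘ z≢z' ∘ sym)
    ; (suc (suc zero)) (suc zero)       → mk⇔ (λ ()) (⊥-elim ∘ z≢z' ∘ sym)
    ; (suc (suc zero)) (suc (suc zero)) → mk⇔ (λ _ → refl) (λ _ → refl)
    }

square⇒aa : {B : Set} {v : List B} → HasSquare v → Occurs aa-word v
square⇒aa (p , z , s , eq) = subst (Occurs aa-word) (sym eq) (aa-at p z s)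

aa⇒square : {B : Set} {v : List B} → Occurs aa-word v → HasSquare v
aa⇒square (p , []          , s , eq , () , _)
aa⇒square (p , _ ∷ []      , s , eq , () , _)
aa⇒square (p , _ ∷ _ ∷ _ ∷ _ , s , eq , () , _)
aa⇒square (p , c ∷ d ∷ [] , s , eq , refl , iso)
  with Equivalence.to (iso zero (suc zero)) refl
... | refl = p , c , s , eq

aab⇒square : {B : Set} {v : List B} → Occurs aab-word v → HasSquare v
aab⇒square (p , []              , s , eq , () , _)
aab⇒square (p , _ ∷ []          , s , eq , () , _)
aab⇒square (p , _ ∷ _ ∷ []      , s , eq , () , _)
aab⇒square (p , _ ∷ _ ∷ _ ∷ _ ∷ _ , s , eq , () , _)
aab⇒square (p , c ∷ d ∷ e ∷ [] , s , eq , refl , iso)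
  with Equivalence.to (iso zero (suc zero)) refl
... | refl = p , c , e ∷ s , eq

Seam : {B : Set} → List B → List B → Set
Seam {B} u l = Σ (List B) λ i → Σ B λ z → Σ (List B) λ r → (u ≡ i ++ [ z ]) × (l ≡ z ∷ r)

square-++ : {B : Set} (u : List B) {l : List B} → HasSquare (u ++ l) →
  HasSquare u ⊎ HasSquare l ⊎ Seam u l
square-++ []            sq                      = inj₂ (inj₁ sq)
square-++ (c ∷ [])      ([] , z , s , refl)     = inj₂ (inj₂ ([] , z , s , refl , refl))
square-++ (c ∷ d ∷ u)   ([] , z , s , refl)     = inj₁ ([] , z , u , refl)
square-++ (c ∷ u)       (q ∷ p , z , s , eq)    =
  Sum.map consSquare (Sum.map₂ consSeam) (square-++ u (p , z , s , ∷-injectiveʳ eq))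
  where
  consSquare : HasSquare u → HasSquare (c ∷ u)
  consSquare (p , z , s , eq) = c ∷ p , z , s , cong (c ∷_) eq
  consSeam : ∀ {l} → Seam u l → Seam (c ∷ u) l
  consSeam (i , z , r , eqᵤ , eqₗ) = c ∷ i , z , r , cong (c ∷_) eqᵤ , eqₗ

NonConstant : {B : Set} → List B → Set
NonConstant {B} u = ∀ z → Σ B λ e → e ∈ u × e ≢ z

module _ {A : Set} (_≟ᴬ_ : DecidableEquality A) where
  open DecMembership _≟ᴬ_ using (_∈?_)

  distinct⇒nonConstant : ∀ {u c d} → c ∈ u → d ∈ u → c ≢ d → NonConstant u
  distinct⇒nonConstant {c = c} {d} c∈ d∈ c≢d z with c ≟ᴬ z
  ... | yes refl = d , d∈ , c≢d ∘ sym
  ... | no c≢z  = c , c∈ , c≢z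

  -- A square zz followed later by a letter other than z yields aab: the
  -- last copy of z in the run starting at the square is followed by a
  -- different letter.
  square-then-other⇒aab : ∀ p z s {e} → e ∈ s → e ≢ z → Occurs aab-word (p ++ z ∷ z ∷ s)
  square-then-other⇒aab p z (t ∷ s) e∈ e≢z with t ≟ᴬ z
  ... | no t≢z = aab-at p s (t≢z ∘ sym)
  ... | yes refl = subst (Occurs aab-word) (++-assoc p [ z ] (z ∷ z ∷ s))
                     (square-then-other⇒aab (p ++ [ z ]) z s (drop-z e∈) e≢z)
    where
    drop-z : _ ∈ z ∷ s → _ ∈ s
    drop-z (here e≡z) = ⊥-elim (e≢z e≡z)
    drop-z (there e∈s) = e∈s

  lastOcc : List A → List A
  lastOcc [] = []
  lastOcc (f ∷ q) with f ∈? q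
  ... | yes _ = lastOcc q
  ... | no  _ = f ∷ lastOcc q

  lastOcc-sound : ∀ q {h} → h ∈ lastOcc q → h ∈ q
  lastOcc-sound (f ∷ q) h∈ with f ∈? q
  lastOcc-sound (f ∷ q) h∈         | yes _ = there (lastOcc-sound q h∈)
  lastOcc-sound (f ∷ q) (here h≡f) | no  _ = here h≡f
  lastOcc-sound (f ∷ q) (there h∈) | no  _ = there (lastOcc-sound q h∈)

  lastOcc-complete : ∀ q {h} → h ∈ q → h ∈ lastOcc q
  lastOcc-complete (f ∷ q) h∈ with f ∈? q
  lastOcc-complete (f ∷ q) (here refl) | yes f∈q = lastOcc-complete q f∈q
  lastOcc-complete (f ∷ q) (there h∈)  | yes _   = lastOcc-complete q h∈
  lastOcc-complete (f ∷ q) (here h≡f)  | no  _   = here h≡f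
  lastOcc-complete (f ∷ q) (there h∈)  | no  _   = there (lastOcc-complete q h∈)

  lastOcc-squarefree : ∀ q → ¬ HasSquare (lastOcc q)
  lastOcc-squarefree []      ([]    , _ , _ , ())
  lastOcc-squarefree []      (_ ∷ _ , _ , _ , ())
  lastOcc-squarefree (f ∷ q) sq with f ∈? q
  lastOcc-squarefree (f ∷ q) sq                   | yes _ = lastOcc-squarefree q sq
  lastOcc-squarefree (f ∷ q) ([] , z , s , eq)    | no f∉q with ∷-injective eq
  ... | refl , eq′ = f∉q (lastOcc-sound q (subst (f ∈_) (sym eq′) (here refl)))
  lastOcc-squarefree (f ∷ q) (_ ∷ p , z , s , eq) | no _ =
    lastOcc-squarefree q (p , z , s , ∷-injectiveʳ eq)

  lastOcc-head≢last : ∀ i z {e r} → e ∈ i ++ [ z ] → e ≢ z → lastOcc (i ++ [ z ]) ≢ z ∷ r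
  lastOcc-head≢last []      z (here e≡z) e≢z eq = e≢z e≡z
  lastOcc-head≢last (f ∷ i) z e∈ e≢z eq with f ∈? (i ++ [ z ])
  ... | no f∉ = f∉ (subst (_∈ i ++ [ z ]) (sym (proj₁ (∷-injective eq))) (∈-++⁺ʳ i (here refl)))
  ... | yes f∈ with e∈
  ...   | here refl = lastOcc-head≢last i z f∈ e≢z eq
  ...   | there e∈′ = lastOcc-head≢last i z e∈′ e≢z eq

  lastOcc-filter : ∀ {p} {P : Pred A p} (P? : Decidable P) q →
    filter P? (lastOcc q) ≡ lastOcc (filter P? q)
  lastOcc-filter P? [] = refl
  lastOcc-filter P? (f ∷ q) with f ∈? q
  lastOcc-filter P? (f ∷ q) | yes f∈q with P? f
  ... | no _ = lastOcc-filter P? q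
  ... | yes Pf with f ∈? filter P? q
  ...   | yes _ = lastOcc-filter P? q
  ...   | no f∉ = ⊥-elim (f∉ (∈-filter⁺ P? f∈q Pf))
  lastOcc-filter P? (f ∷ q) | no f∉q with P? f
  ... | no _ = lastOcc-filter P? q
  ... | yes _ with f ∈? filter P? q
  ...   | yes f∈ = ⊥-elim (f∉q (proj₁ (∈-filter⁻ P? f∈)))
  ...   | no _ = cong (f ∷_) (lastOcc-filter P? q)

  squarefree-closed : ∀ u → NonConstant u → ¬ HasSquare u → ¬ HasSquare (u ++ lastOcc u)
  squarefree-closed u nonconst u-sqfree sq with square-++ u sq
  ... | inj₁ sqᵤ = u-sqfree sqᵤ
  ... | inj₂ (inj₁ sqₗ) = lastOcc-squarefree u sqₗ
  ... | inj₂ (inj₂ (i , z , r , refl , eqₗ)) with nonconst z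
  ...   | e , e∈ , e≢z = lastOcc-head≢last i z e∈ e≢z eqₗ

  -- A square in u is followed by a different letter inside u ++ lastOcc u.
  square-closed : ∀ u → NonConstant u → HasSquare u → Occurs aab-word (u ++ lastOcc u)
  square-closed u nonconst (p , z , s , refl) with nonconst z
  ... | e , e∈ , e≢z =
    subst (Occurs aab-word) (sym (++-assoc p (z ∷ z ∷ s) (lastOcc u)))
      (square-then-other⇒aab p z (s ++ lastOcc u) (∈-++⁺ʳ s (lastOcc-complete u e∈)) e≢z)

  aa-avoiding⇔closure-aab-avoiding : ∀ u → NonConstant u →
    Avoids aa-word u ⇔ Avoids aab-word (u ++ lastOcc u)
  aa-avoiding⇔closure-aab-avoiding u nonconst = mk⇔
    (λ avoids-aa → squarefree-closed u nonconst (avoids-aa ∘ square⇒aa) ∘ aab⇒square)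
    (λ avoids-aab → avoids-aab ∘ square-closed u nonconst ∘ aa⇒square)

theorem10 : (n : ℕ) (G : Graph n) →
    Representable aa-word G → Representable aab-word G
theorem10 n G (w , w-covers , represents) =
  w ++ lastOcc _≟_ w , (λ x → ∈-++⁺ˡ (w-covers x)) , represents′
  where
  represents′ : ∀ x y → x ≢ y → Adj G x y ⇔ Avoids aab-word (restrict (w ++ lastOcc _≟_ w) x y)
  represents′ x y x≢y =
    subst (λ v → Adj G x y ⇔ Avoids aab-word v) (sym restrict-closure)
      (aa-avoiding⇔closure-aab-avoiding _≟_ u nonconst ⇔-∘ represents x y x≢y)
    where
    P? : Decidable (λ z → z ≡ x ⊎ z ≡ y)
    P? z = (z ≟ x) ⊎-dec (z ≟ y)
    u : List (Fin n)
    u = restrict w x y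
    nonconst : NonConstant u
    nonconst = distinct⇒nonConstant _≟_
      (∈-filter⁺ P? (w-covers x) (inj₁ refl)) (∈-filter⁺ P? (w-covers y) (inj₂ refl)) x≢y
    restrict-closure : restrict (w ++ lastOcc _≟_ w) x y ≡ u ++ lastOcc _≟_ u
    restrict-closure = trans (filter-++ P? w (lastOcc _≟_ w)) (cong (u ++_) (lastOcc-filter _≟_ P? w))
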